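{- Let $G_5=\mathbb{Z}_5\times\mathbb{Z}_5$, let $S=\{(i,0),(0,i),(i,i): 1\leq i\leq 4\}\subset G_5$, and let $\Gamma(5)=\mathrm{Cay}(G_5;S)$ (vertices $G_5$, $g\sim h$ iff $h-g\in S$). Then $\Gamma(5)$ is distance-transitive but not $2$-arc-transitive.
   Context: A graph $\Gamma$ is distance-transitive if for all vertices $u,v,x,y$ with $d(u,v)=d(x,y)$ there is an automorphism $\pi$ with $\pi(u)=x$, $\pi(v)=y$. A $2$-arc is a sequence $(v_0,v_1,v_2)$ of vertices with $v_0\sim v_1\sim v_2$ and $v_0\neq v_2$; $\Gamma$ is $2$-arc-transitive if its automorphism group acts transitively on the set of $2$-arcs. -}

module Defs where

open import Data.Nat using (ℕ; zero; suc; _+_; _∸_; _<_)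
open import Data.Nat.DivMod using (_mod_)
open import Data.Fin using (Fin; toℕ)
open import Data.Product using (_×_; _,_; Σ)
open import Data.Sum using (_⊎_)
open import Relation.Binary.PropositionalEquality using (_≡_; _≢_)
open import Relation.Nullary using (¬_)
open import Function.Bundles using (_⤖_; Bijection)

data Walk {V : Set} (_∼_ : V → V → Set) : V → V → ℕ → Set where
  here : ∀ {u} → Walk _∼_ u u zero
  step : ∀ {u v w n} → u ∼ v → Walk _∼_ v w n → Walk _∼_ u w (suc n)

Dist : {V : Set} → (V → V → Set) → V → V → ℕ → Set
Dist _∼_ u v k = Walk _∼_ u v k × (∀ m → m < k → ¬ Walk _∼_ u v m)

record Automorphism {V : Set} (_∼_ : V → V → Set) : Set where
  field
    perm     : V ⤖ V
    preserve : ∀ u v → u ∼ v → Bijection.to perm u ∼ Bijection.to perm v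
    reflect  : ∀ u v → Bijection.to perm u ∼ Bijection.to perm v → u ∼ v

open Automorphism public

app : {V : Set} {_∼_ : V → V → Set} → Automorphism _∼_ → V → V
app π = Bijection.to (perm π)

DistanceTransitive : {V : Set} → (V → V → Set) → Set
DistanceTransitive {V} _∼_ =
  ∀ (u v x y : V) (k : ℕ) → Dist _∼_ u v k → Dist _∼_ x y k →
  Σ (Automorphism _∼_) λ π → (app π u ≡ x) × (app π v ≡ y)

TwoArc : {V : Set} → (V → V → Set) → V → V → V → Set
TwoArc _∼_ a b c = (a ∼ b) × (b ∼ c) × (a ≢ c)

TwoArcTransitive : {V : Set} → (V → V → Set) → Set
TwoArcTransitive {V} _∼_ =
  ∀ (a b c a' b' c' : V) → TwoArc _∼_ a b c → TwoArc _∼_ a' b' c' →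
  Σ (Automorphism _∼_) λ π → (app π a ≡ a') × (app π b ≡ b') × (app π c ≡ c')

Z5 : Set
Z5 = Fin 5

G5 : Set
G5 = Z5 × Z5

_-₅_ : Z5 → Z5 → Z5
a -₅ b = (toℕ a + (5 ∸ toℕ b)) mod 5

_-G_ : G5 → G5 → G5
(a₁ , a₂) -G (b₁ , b₂) = (a₁ -₅ b₁) , (a₂ -₅ b₂)

InS : G5 → Set
InS (a , b) = ((a ≢ Fin.zero) × (b ≡ Fin.zero))
            ⊎ ((a ≡ Fin.zero) × (b ≢ Fin.zero))
            ⊎ ((a ≢ Fin.zero) × (a ≡ b))

_∼Γ5_ : G5 → G5 → Set
g ∼Γ5 h = InS (h -G g)

{-# OPTIONS --safe #-}
-- Γ(5) is a Cayley graph, so the translations of ℤ₅² act transitively on its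
-- vertices, and every group automorphism of ℤ₅² fixing S setwise fixes 0 and
-- is a graph automorphism. Three of them, doubling, the coordinate swap and
-- the shear (a , b) ↦ (a , a − b), already generate a group acting
-- transitively on S (the sphere of radius 1 about 0) and on the twelve
-- remaining non-zero vertices (the sphere of radius 2); together with the
-- translations this gives distance-transitivity. Γ(5) is not 2-arc-transitive
-- because the 2-arc 0 , (1,0) , (2,0) closes a triangle while the 2-arc
-- 0 , (1,0) , (1,2) does not.
module Submission where

open import Defs
open import Data.Bool using (if_then_else_)
open import Data.Fin as Fin using (Fin; #_; toℕ)
open import Data.Fin.Properties using (all?)
open import Data.List using (List; []; _∷_; foldr; cartesianProductWith)
open import Data.List.Relation.Unary.Any using (Any; satisfied)
import Data.List.Relation.Unary.Any as Any
open import Data.Nat using (ℕ; zero; suc; _+_; _*_; s≤s)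
open import Data.Nat.DivMod using (_mod_)
open import Data.Nat.Properties using (≤-antisym; ≮⇒≥)
open import Data.Product using (_×_; _,_; proj₂; Σ; swap)
open import Data.Product.Properties using (≡-dec)
open import Function using (_∘_; id)
open import Function.Bundles using (Bijection; mk↔ₛ′)
open import Function.Construct.Composition using (_⤖-∘_)
open import Function.Construct.Identity using (⤖-id)
open import Function.Construct.Symmetry using (⤖-sym)
open import Function.Properties.Inverse using (↔⇒⤖)
open import Relation.Binary.Definitions using (DecidableEquality)
open import Relation.Binary.PropositionalEquality
open import Relation.Nullary using (¬_; Dec; does)
open import Relation.Nullary.Decidable using (from-yes; from-no; map′; ¬?; _×-dec_; _⊎-dec_; _→-dec_)
open import Relation.Unary using (Decidable)

module _ {V : Set} {_∼_ : V → V → Set} where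

  mkAutomorphism : (f g : V → V) → (∀ x → f (g x) ≡ x) → (∀ x → g (f x) ≡ x) →
                   (∀ u v → u ∼ v → f u ∼ f v) → (∀ u v → f u ∼ f v → u ∼ v) →
                   Automorphism _∼_
  mkAutomorphism f g f∘g g∘f preserves reflects = record
    { perm = ↔⇒⤖ (mk↔ₛ′ f g f∘g g∘f) ; preserve = preserves ; reflect = reflects }

  id-aut : Automorphism _∼_
  id-aut = record { perm = ⤖-id V ; preserve = λ _ _ → id ; reflect = λ _ _ → id }

  _∘-aut_ : Automorphism _∼_ → Automorphism _∼_ → Automorphism _∼_
  π ∘-aut σ = record
    { perm     = perm π ⤖-∘ perm σ
    ; preserve = λ u v → preserve π _ _ ∘ preserve σ u v
    ; reflect  = λ u v → reflect σ u v ∘ reflect π _ _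
    }

  app-inverse-app : (π : Automorphism _∼_) →
                    ∀ y → app π (Bijection.to⁻ (perm π) y) ≡ y
  app-inverse-app π y = proj₂ (Bijection.strictlySurjective (perm π) y)

  inverse-aut : Automorphism _∼_ → Automorphism _∼_
  inverse-aut π = record
    { perm     = ⤖-sym (perm π)
    ; preserve = λ u v → reflect π _ _ ∘
                   subst₂ _∼_ (sym (app-inverse-app π u)) (sym (app-inverse-app π v))
    ; reflect  = λ u v → subst₂ _∼_ (app-inverse-app π u) (app-inverse-app π v) ∘
                   preserve π _ _
    }

  inverse-aut-app : (π : Automorphism _∼_) → ∀ {x y} → app π x ≡ y → app (inverse-aut π) y ≡ x
  inverse-aut-app π {x} {y} πx≡y =
    Bijection.injective (perm π) (trans (app-inverse-app π y) (sym πx≡y))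

  map-walk : (π : Automorphism _∼_) → ∀ {u v k} →
             Walk _∼_ u v k → Walk _∼_ (app π u) (app π v) k
  map-walk π here         = here
  map-walk π (step p ws) = step (preserve π _ _ p) (map-walk π ws)

  unmap-walk : (π : Automorphism _∼_) → ∀ {u v k} →
               Walk _∼_ (app π u) (app π v) k → Walk _∼_ u v k
  unmap-walk π {u} {v} {k} ws =
    subst₂ (λ x y → Walk _∼_ x y k) (inverse-aut-app π refl) (inverse-aut-app π refl)
           (map-walk (inverse-aut π) ws)

  map-dist : (π : Automorphism _∼_) → ∀ {u v k} →
             Dist _∼_ u v k → Dist _∼_ (app π u) (app π v) k
  map-dist π (ws , shortest) = map-walk π ws , λ m m<k → shortest m m<k ∘ unmap-walk π

  dist-unique : ∀ {u v m n} → Dist _∼_ u v m → Dist _∼_ u v n → m ≡ n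
  dist-unique (wm , shortestm) (wn , shortestn) =
    ≤-antisym (≮⇒≥ λ n<m → shortestm _ n<m wn) (≮⇒≥ λ m<n → shortestn _ m<n wm)

  -- The classical criterion: the graph is vertex-transitive and the
  -- stabiliser of o is transitive on every sphere about o.
  module _ (o : V) (rep : ℕ → V)
           (moveTo-o : ∀ u → Σ (Automorphism _∼_) λ τ → app τ u ≡ o)
           (stabiliser : ∀ v k → Dist _∼_ o v k →
                         Σ (Automorphism _∼_) λ σ → app σ o ≡ o × app σ v ≡ rep k)
           where

    normalise : ∀ u v k → Dist _∼_ u v k →
                Σ (Automorphism _∼_) λ π → app π u ≡ o × app π v ≡ rep k
    normalise u v k d with moveTo-o u
    ... | τ , τu≡o with stabiliser (app τ v) k (subst (λ w → Dist _∼_ w (app τ v) k) τu≡o (map-dist τ d))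
    ... | σ , σo≡o , σv≡rep = σ ∘-aut τ , trans (cong (app σ) τu≡o) σo≡o , σv≡rep

    distanceTransitive : DistanceTransitive _∼_
    distanceTransitive u v x y k uv xy with normalise u v k uv | normalise x y k xy
    ... | π , πu≡o , πv≡rep | ρ , ρx≡o , ρy≡rep =
      inverse-aut ρ ∘-aut π ,
      inverse-aut-app ρ (trans ρx≡o (sym πu≡o)) ,
      inverse-aut-app ρ (trans ρy≡rep (sym πv≡rep))

  ¬twoArcTransitive : ∀ {a b c a′ b′ c′} →
    TwoArc _∼_ a b c → a ∼ c → TwoArc _∼_ a′ b′ c′ → ¬ a′ ∼ c′ →
    ¬ TwoArcTransitive _∼_
  ¬twoArcTransitive abc a∼c abc′ a′≁c′ arcTransitive
    with arcTransitive _ _ _ _ _ _ abc abc′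
  ... | π , πa≡a′ , _ , πc≡c′ = a′≁c′ (subst₂ _∼_ πa≡a′ πc≡c′ (preserve π _ _ a∼c))

0G : G5
0G = # 0 , # 0

_≟G_ : DecidableEquality G5
_≟G_ = ≡-dec Fin._≟_ Fin._≟_

InS? : Decidable InS
InS? (a , b) = (¬? (a Fin.≟ # 0) ×-dec b Fin.≟ # 0)
             ⊎-dec (a Fin.≟ # 0 ×-dec ¬? (b Fin.≟ # 0))
             ⊎-dec (¬? (a Fin.≟ # 0) ×-dec a Fin.≟ b)

all-G5? : {P : G5 → Set} → Decidable P → Dec (∀ g → P g)
all-G5? P? = map′ (λ p (a , b) → p a b) (λ p a b → p (a , b)) (all? λ a → all? λ b → P? (a , b))

_+G_ : G5 → G5 → G5
(a₁ , a₂) +G (b₁ , b₂) = (toℕ a₁ + toℕ b₁) mod 5 , (toℕ a₂ + toℕ b₂) mod 5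

[g-t]-[h-t]≡g-h : ∀ g h t → (g -G t) -G (h -G t) ≡ g -G h
[g-t]-[h-t]≡g-h = from-yes (all-G5? λ g → all-G5? λ h → all-G5? λ t → ((g -G t) -G (h -G t)) ≟G (g -G h))

g-g≡0 : ∀ g → g -G g ≡ 0G
g-g≡0 = from-yes (all-G5? λ g → (g -G g) ≟G 0G)

[g+t]-t≡g : ∀ g t → (g +G t) -G t ≡ g
[g+t]-t≡g = from-yes (all-G5? λ g → all-G5? λ t → ((g +G t) -G t) ≟G g)

[g-t]+t≡g : ∀ g t → (g -G t) +G t ≡ g
[g-t]+t≡g = from-yes (all-G5? λ g → all-G5? λ t → ((g -G t) +G t) ≟G g)

_∼?_ : ∀ g h → Dec (g ∼Γ5 h)
g ∼? h = InS? (h -G g)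

translation : G5 → Automorphism _∼Γ5_
translation t = mkAutomorphism (_-G t) (_+G t) (λ g → [g+t]-t≡g g t) (λ g → [g-t]+t≡g g t)
  (λ u v → subst InS (sym ([g-t]-[h-t]≡g-h v u t)))
  (λ u v → subst InS ([g-t]-[h-t]≡g-h v u t))

IsGroupAutomorphismFixingS : (f f⁻¹ : G5 → G5) → Set
IsGroupAutomorphismFixingS f f⁻¹ =
  (∀ g → f (f⁻¹ g) ≡ g) × (∀ g → f⁻¹ (f g) ≡ g) ×
  (∀ g h → f g -G f h ≡ f (g -G h)) ×
  (∀ s → InS s → InS (f s)) × (∀ s → InS (f s) → InS s)

isGroupAutomorphismFixingS? : ∀ f f⁻¹ → Dec (IsGroupAutomorphismFixingS f f⁻¹)
isGroupAutomorphismFixingS? f f⁻¹ =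
  all-G5? (λ g → f (f⁻¹ g) ≟G g) ×-dec all-G5? (λ g → f⁻¹ (f g) ≟G g) ×-dec
  all-G5? (λ g → all-G5? λ h → (f g -G f h) ≟G f (g -G h)) ×-dec
  all-G5? (λ s → InS? s →-dec InS? (f s)) ×-dec all-G5? (λ s → InS? (f s) →-dec InS? s)

toGraphAutomorphism : ∀ {f f⁻¹} → IsGroupAutomorphismFixingS f f⁻¹ → Automorphism _∼Γ5_
toGraphAutomorphism {f} {f⁻¹} (f∘f⁻¹ , f⁻¹∘f , homomorphic , preservesS , reflectsS) =
  mkAutomorphism f f⁻¹ f∘f⁻¹ f⁻¹∘f
    (λ u v → subst InS (sym (homomorphic v u)) ∘ preservesS (v -G u))
    (λ u v → reflectsS (v -G u) ∘ subst InS (homomorphic v u))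

groupAutomorphism-fixes-0G : ∀ {f f⁻¹} → IsGroupAutomorphismFixingS f f⁻¹ → f 0G ≡ 0G
groupAutomorphism-fixes-0G {f} (_ , _ , homomorphic , _) = begin
  f 0G           ≡⟨ cong f (sym (g-g≡0 0G)) ⟩
  f (0G -G 0G)   ≡⟨ sym (homomorphic 0G 0G) ⟩
  f 0G -G f 0G   ≡⟨ g-g≡0 (f 0G) ⟩
  0G             ∎
  where open ≡-Reasoning

scale : Z5 → G5 → G5
scale k (a , b) = (toℕ k * toℕ a) mod 5 , (toℕ k * toℕ b) mod 5

data Generator : Set where
  doubling transposition shear : Generator

generators : List Generator
generators = doubling ∷ transposition ∷ shear ∷ []

generatorMap generatorMap⁻¹ : Generator → G5 → G5
generatorMap doubling      = scale (# 2)
generatorMap transposition = swap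
generatorMap shear         = λ (a , b) → a , a -₅ b
generatorMap⁻¹ doubling      = scale (# 3)
generatorMap⁻¹ transposition = swap
generatorMap⁻¹ shear         = generatorMap shear

generator-fixesS : ∀ x → IsGroupAutomorphismFixingS (generatorMap x) (generatorMap⁻¹ x)
generator-fixesS doubling      = from-yes (isGroupAutomorphismFixingS? (generatorMap doubling) (generatorMap⁻¹ doubling))
generator-fixesS transposition = from-yes (isGroupAutomorphismFixingS? (generatorMap transposition) (generatorMap⁻¹ transposition))
generator-fixesS shear         = from-yes (isGroupAutomorphismFixingS? (generatorMap shear) (generatorMap⁻¹ shear))

word : List Generator → Automorphism _∼Γ5_
word = foldr (λ x π → toGraphAutomorphism (generator-fixesS x) ∘-aut π) id-aut

word-fixes-0G : ∀ xs → app (word xs) 0G ≡ 0G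
word-fixes-0G []       = refl
word-fixes-0G (x ∷ xs) =
  trans (cong (generatorMap x) (word-fixes-0G xs)) (groupAutomorphism-fixes-0G (generator-fixesS x))

wordsUpTo : ℕ → List (List Generator)
wordsUpTo zero    = [] ∷ []
wordsUpTo (suc n) = [] ∷ cartesianProductWith _∷_ generators (wordsUpTo n)

sphereRep : ℕ → G5
sphereRep 0 = 0G
sphereRep 1 = # 1 , # 0
sphereRep _ = # 1 , # 2

dist-sphereRep : ∀ (i : Fin 3) → Dist _∼Γ5_ 0G (sphereRep (toℕ i)) (toℕ i)
dist-sphereRep Fin.zero = here , λ _ ()
dist-sphereRep (Fin.suc Fin.zero) =
  step (from-yes (0G ∼? (# 1 , # 0))) here , λ { zero _ () ; (suc _) (s≤s ()) _ }
dist-sphereRep (Fin.suc (Fin.suc Fin.zero)) =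
  step {v = # 1 , # 0} (from-yes (0G ∼? (# 1 , # 0))) (step (from-yes ((# 1 , # 0) ∼? (# 1 , # 2))) here) ,
  λ { zero _ ()
    ; (suc zero) _ (step 0G∼rep here) → from-no (0G ∼? (# 1 , # 2)) 0G∼rep
    ; (suc (suc _)) (s≤s (s≤s ())) _ }

sphereIndex : G5 → Fin 3
sphereIndex v = if does (v ≟G 0G) then # 0 else if does (InS? v) then # 1 else # 2

-- Words of length at most 4 suffice. Opaque because unfolding the proof term
-- produced by this exhaustive search at use sites is prohibitively expensive.
opaque
  word-toSphereRep : ∀ v → Any (λ xs → app (word xs) v ≡ sphereRep (toℕ (sphereIndex v))) (wordsUpTo 4)
  word-toSphereRep = from-yes (all-G5? λ v →
    Any.any? (λ xs → app (word xs) v ≟G sphereRep (toℕ (sphereIndex v))) (wordsUpTo 4))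

stabiliser-transitive-on-spheres : ∀ v k → Dist _∼Γ5_ 0G v k →
  Σ (Automorphism _∼Γ5_) λ σ → app σ 0G ≡ 0G × app σ v ≡ sphereRep k
stabiliser-transitive-on-spheres v k d with satisfied (word-toSphereRep v)
... | xs , xs·v≡rep = word xs , word-fixes-0G xs , trans xs·v≡rep (cong sphereRep i≡k)
  where
  i≡k : toℕ (sphereIndex v) ≡ k
  i≡k = dist-unique (dist-sphereRep (sphereIndex v))
    (subst₂ (λ a b → Dist _∼Γ5_ a b k) (word-fixes-0G xs) xs·v≡rep (map-dist (word xs) d))

twoArc? : ∀ a b c → Dec (TwoArc _∼Γ5_ a b c)
twoArc? a b c = a ∼? b ×-dec b ∼? c ×-dec ¬? (a ≟G c)

triangle-arc : TwoArc _∼Γ5_ 0G (# 1 , # 0) (# 2 , # 0)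
triangle-arc = from-yes (twoArc? 0G (# 1 , # 0) (# 2 , # 0))

induced-path-arc : TwoArc _∼Γ5_ 0G (# 1 , # 0) (# 1 , # 2)
induced-path-arc = from-yes (twoArc? 0G (# 1 , # 0) (# 1 , # 2))

proposition3p4 : DistanceTransitive _∼Γ5_ × ¬ TwoArcTransitive _∼Γ5_
proposition3p4 =
  distanceTransitive 0G sphereRep (λ u → translation u , g-g≡0 u) stabiliser-transitive-on-spheres ,
  ¬twoArcTransitive {b = # 1 , # 0} {b′ = # 1 , # 0}
    triangle-arc (from-yes (0G ∼? (# 2 , # 0))) induced-path-arc (from-no (0G ∼? (# 1 , # 2)))
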